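{- Let $s,t,k \ge 2$ be integers and let $Y \in \{F^1_t, F^2_t\}$. The class of $\{Y, (s,t)\text{ -bowtie}, (k,t)\text{ -lollipop}\}$-free graphs is $(2t-2)$-strongly Pollyanna.
   Context: All graphs are finite, simple and undirected; "$H$-free" means having no induced subgraph isomorphic to $H$, and $\mathcal{H}$-free means $H$-free for every $H\in\mathcal{H}$. $\chi(G)$ is the chromatic number and $\omega(G)$ the clique number. $F^1_t$ is obtained from $K_t$ by adding two new non-adjacent vertices, each adjacent to all vertices of the $K_t$. $F^2_t$ is obtained from $K_t$ by adding three new pairwise non-adjacent vertices, each adjacent to all vertices of the $K_t$. An $(s,t)$-bowtie is obtained from the disjoint union of $K_s$ and $K_t$ by adding a new vertex adjacent to all other vertices. A $(k,t)$-lollipop is obtained from a complete graph $K_t$ and a disjoint star $S_k$ on $k$ vertices by joining the center of the star to every vertex of $K_t$. For an integer $n$, $\chi^{(n)}(G)$ denotes the maximum chromatic number of an induced subgraph $H$ of $G$ with $\omega(H)\le n$. A class $\mathcal{F}$ is $n$-good if it is hereditary and there is a constant $m$ with $\chi^{(n)}(G)\le m$ for all $G\in\mathcal{F}$. A hereditary class is polynomially $\chi$-bounded if there is a polynomial $f$ with $\chi(G)\le f(\omega(G))$ for every $G$ in the class. A class $\mathcal{C}$ is $n$-strongly Pollyanna if for every $n$-good class $\mathcal{F}$, the class $\mathcal{C}\cap\mathcal{F}$ is polynomially $\chi$-bounded. -}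

module Defs where

open import Data.Nat using (ℕ; zero; suc; _+_; _*_; _^_; _∸_; _≤_)
open import Data.Fin using (Fin; zero; suc; splitAt; _≟_)
open import Data.Bool using (Bool; true; false; not; _∧_)
open import Data.Sum using (_⊎_; inj₁; inj₂)
open import Data.Product using (Σ; ∃; _×_; _,_)
open import Data.List using (List; []; _∷_)
open import Relation.Nullary using (¬_; does; yes; no)
open import Relation.Binary.PropositionalEquality using (_≡_; _≢_; refl; sym)
open import Function.Definitions using (Injective)

record Graph : Set where
  field
    size  : ℕ
    edge  : Fin size → Fin size → Bool
    esym  : ∀ u v → edge u v ≡ edge v u
    irref : ∀ v → edge v v ≡ false

open Graph public

Adj : (G : Graph) → Fin (size G) → Fin (size G) → Set
Adj G u v = edge G u v ≡ true

InducedSub : Graph → Graph → Set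
InducedSub H G =
  Σ (Fin (size H) → Fin (size G)) λ φ →
    Injective _≡_ _≡_ φ × (∀ u v → edge G (φ u) (φ v) ≡ edge H u v)

Free : Graph → Graph → Set
Free H G = ¬ InducedSub H G

HasClique : Graph → ℕ → Set
HasClique G k =
  Σ (Fin k → Fin (size G)) λ φ →
    Injective _≡_ _≡_ φ × (∀ i j → i ≢ j → Adj G (φ i) (φ j))

CliqueNumber : Graph → ℕ → Set
CliqueNumber G w = HasClique G w × ¬ HasClique G (suc w)

CliqueAtMost : Graph → ℕ → Set
CliqueAtMost G n = ¬ HasClique G (suc n)

Colorable : Graph → ℕ → Set
Colorable G c =
  Σ (Fin (size G) → Fin c) λ f → ∀ u v → Adj G u v → f u ≢ f v

Class : Set₁
Class = Graph → Set

Hereditary : Class → Set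
Hereditary C = ∀ G H → C G → InducedSub H G → C H

ChiNBounded : ℕ → Graph → ℕ → Set
ChiNBounded n G m = ∀ H → InducedSub H G → CliqueAtMost H n → Colorable H m

NGood : ℕ → Class → Set
NGood n F = Hereditary F × ∃ λ m → ∀ G → F G → ChiNBounded n G m

-- polynomials with natural-number coefficients (constant term first)
Poly : Set
Poly = List ℕ

eval : Poly → ℕ → ℕ
eval []       x = 0
eval (a ∷ as) x = a + x * eval as x

PolyChiBounded : Class → Set
PolyChiBounded C =
  Σ Poly λ f → ∀ G → C G → ∀ w → CliqueNumber G w → Colorable G (eval f w)

StronglyPollyanna : ℕ → Class → Set₁
StronglyPollyanna n C = (F : Class) → NGood n F → PolyChiBounded (λ G → C G × F G)

neq : ∀ {n} → Fin n → Fin n → Bool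
neq a b = not (does (a ≟ b))

neq-sym : ∀ {n} (a b : Fin n) → neq a b ≡ neq b a
neq-sym a b with a ≟ b | b ≟ a
... | yes _ | yes _ = refl
... | no _  | no _  = refl
... | yes p | no q  with q (sym p)
... | ()
neq-sym a b | no q | yes p with q (sym p)
... | ()

neq-irr : ∀ {n} (a : Fin n) → neq a a ≡ false
neq-irr a with a ≟ a
... | yes _ = refl
... | no q with q refl
... | ()

-- K_t joined to an independent set of r vertices
-- vertices: inj₁ (clique part, Fin t), inj₂ (independent part, Fin r)
joinE : (t r : ℕ) → Fin (t + r) → Fin (t + r) → Bool
joinE t r u v with splitAt t u | splitAt t v
... | inj₁ a | inj₁ b = neq a b
... | inj₁ _ | inj₂ _ = true
... | inj₂ _ | inj₁ _ = true
... | inj₂ _ | inj₂ _ = false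

joinE-sym : (t r : ℕ) → ∀ u v → joinE t r u v ≡ joinE t r v u
joinE-sym t r u v with splitAt t u | splitAt t v
... | inj₁ a | inj₁ b = neq-sym a b
... | inj₁ _ | inj₂ _ = refl
... | inj₂ _ | inj₁ _ = refl
... | inj₂ _ | inj₂ _ = refl

joinE-irr : (t r : ℕ) → ∀ v → joinE t r v v ≡ false
joinE-irr t r v with splitAt t v
... | inj₁ a = neq-irr a
... | inj₂ _ = refl

KJoinIndep : ℕ → ℕ → Graph
KJoinIndep t r = record
  { size = t + r ; edge = joinE t r ; esym = joinE-sym t r ; irref = joinE-irr t r }

F1 : ℕ → Graph
F1 t = KJoinIndep t 2

F2 : ℕ → Graph
F2 t = KJoinIndep t 3

-- (s,t)-bowtie: vertex zero is the apex; suc (inj₁ a) ∈ K_s, suc (inj₂ b) ∈ K_t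
bowE : (s t : ℕ) → Fin (suc (s + t)) → Fin (suc (s + t)) → Bool
bowE s t zero    zero    = false
bowE s t zero    (suc _) = true
bowE s t (suc _) zero    = true
bowE s t (suc u) (suc v) with splitAt s u | splitAt s v
... | inj₁ a | inj₁ b = neq a b
... | inj₁ _ | inj₂ _ = false
... | inj₂ _ | inj₁ _ = false
... | inj₂ a | inj₂ b = neq a b

bowE-sym : (s t : ℕ) → ∀ u v → bowE s t u v ≡ bowE s t v u
bowE-sym s t zero    zero    = refl
bowE-sym s t zero    (suc _) = refl
bowE-sym s t (suc _) zero    = refl
bowE-sym s t (suc u) (suc v) with splitAt s u | splitAt s v
... | inj₁ a | inj₁ b = neq-sym a b
... | inj₁ _ | inj₂ _ = refl
... | inj₂ _ | inj₁ _ = refl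
... | inj₂ a | inj₂ b = neq-sym a b

bowE-irr : (s t : ℕ) → ∀ v → bowE s t v v ≡ false
bowE-irr s t zero = refl
bowE-irr s t (suc v) with splitAt s v
... | inj₁ a = neq-irr a
... | inj₂ a = neq-irr a

Bowtie : ℕ → ℕ → Graph
Bowtie s t = record
  { size = suc (s + t) ; edge = bowE s t ; esym = bowE-sym s t ; irref = bowE-irr s t }

-- (k,t)-lollipop: vertex zero is the star centre; suc (inj₁ a) are the
-- k ∸ 1 leaves of the star S_k, suc (inj₂ b) are the vertices of K_t
lolE : (l t : ℕ) → Fin (suc (l + t)) → Fin (suc (l + t)) → Bool
lolE l t zero    zero    = false
lolE l t zero    (suc _) = true
lolE l t (suc _) zero    = true
lolE l t (suc u) (suc v) with splitAt l u | splitAt l v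
... | inj₁ _ | inj₁ _ = false
... | inj₁ _ | inj₂ _ = false
... | inj₂ _ | inj₁ _ = false
... | inj₂ a | inj₂ b = neq a b

lolE-sym : (l t : ℕ) → ∀ u v → lolE l t u v ≡ lolE l t v u
lolE-sym l t zero    zero    = refl
lolE-sym l t zero    (suc _) = refl
lolE-sym l t (suc _) zero    = refl
lolE-sym l t (suc u) (suc v) with splitAt l u | splitAt l v
... | inj₁ _ | inj₁ _ = refl
... | inj₁ _ | inj₂ _ = refl
... | inj₂ _ | inj₁ _ = refl
... | inj₂ a | inj₂ b = neq-sym a b

lolE-irr : (l t : ℕ) → ∀ v → lolE l t v v ≡ false
lolE-irr l t zero = refl
lolE-irr l t (suc v) with splitAt l v
... | inj₁ _ = refl
... | inj₂ a = neq-irr a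

Lollipop : ℕ → ℕ → Graph
Lollipop k t = record
  { size = suc ((k ∸ 1) + t) ; edge = lolE (k ∸ 1) t
  ; esym = lolE-sym (k ∸ 1) t ; irref = lolE-irr (k ∸ 1) t }

-- Call a vertex heavy if its neighbourhood contains a clique Q on p = 2t − 2 vertices.
-- The light vertices induce a subgraph of clique number at most p, so the p-good class
-- colours them with a constant number of colours.  A heavy vertex x has few neighbours:
-- split N(x) into at most 2^p parts Y according to adjacency to Q.  Such a part is complete
-- to some Z₁ ⊆ Q and anticomplete to Z₀ = Q ∖ Z₁, where |Z₀| + |Z₁| = 2t − 2.  If |Z₀| ≥ t,
-- Ramsey's theorem in Y gives an s-clique, which with x and Z₀ forms an (s,t)-bowtie, or
-- k − 1 independent vertices, which form a (k,t)-lollipop.  Otherwise {x} ∪ Z₁ contains a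
-- t-clique complete to Y, and Ramsey gives an (ω+1)-clique or r independent vertices that
-- complete K_t joined to r independent vertices (F¹_t for r = 2, F²_t for r = 3).  So heavy
-- vertices have degree at most 2^p (R(s,k−1) + R(ω+1,r)), a polynomial in ω, and are
-- coloured greedily with further colours.

module Submission where

open import Defs
open import Data.Nat using (ℕ; zero; suc; _+_; _*_; _∸_; _^_; _≤_; z≤n; s≤s)
open import Data.Nat.Properties
  using (_≤?_; ≤-reflexive; ≤-trans; ≰⇒>; ≰⇒≥; <⇒≤; <⇒≱; m≤m+n; m≤n+m; +-mono-≤; +-mono-≤-<;
         +-monoʳ-≤; *-monoʳ-≤; +-identityʳ; +-suc; +-assoc; *-assoc; *-zeroʳ; *-distribˡ-+;
         module ≤-Reasoning)
open import Data.Nat.Tactic.RingSolver using (solve-∀)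
open import Data.Bool using (Bool; true; false)
open import Data.Bool.Properties using (¬-not; not-¬) renaming (_≟_ to _≟ᵇ_)
open import Data.Fin using (Fin; zero; suc; splitAt; join; inject≤; _≟_)
open import Data.Fin.Properties
  using (join-splitAt; splitAt-join; inject≤-injective; suc-injective; pigeonhole; <⇒≢; any?)
open import Data.List using (List; []; _∷_; length; filter; lookup; map; tabulate; allFin)
open import Data.List.Properties using (length-map; length-tabulate)
open import Data.List.Membership.Propositional using (_∈_; _∉_)
open import Data.List.Membership.Propositional.Properties
  using (∈-lookup; ∈-filter⁻; ∈-filter⁺; ∈-map⁺; ∈-allFin)
open import Data.List.Relation.Binary.Subset.Propositional using (_⊆_)
open import Data.List.Relation.Binary.Subset.Propositional.Properties using (⊆-refl; filter-⊆)
open import Data.List.Relation.Unary.All as All using (All; []; _∷_)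
open import Data.List.Relation.Unary.All.Properties using (all-filter; anti-mono; filter⁺)
  renaming (tabulate⁺ to All-tabulate⁺)
open import Data.List.Relation.Unary.AllPairs using (AllPairs; []; _∷_; allPairs?)
open import Data.List.Relation.Unary.AllPairs.Properties using ()
  renaming (tabulate⁺ to AllPairs-tabulate⁺; filter⁺ to AllPairs-filter⁺)
open import Data.List.Relation.Unary.Any as Any using (here; there; index)
open import Data.List.Relation.Unary.Any.Properties using (lookup-index)
open import Data.List.Relation.Unary.Unique.Propositional using (Unique)
import Data.List.Relation.Unary.Unique.Propositional.Properties as Unique
open import Data.List.Relation.Unary.Unique.Propositional.Properties using (allFin⁺)
open import Data.Product using (Σ; ∃; _×_; _,_; proj₁; proj₂)
open import Data.Sum using (_⊎_; inj₁; inj₂; [_,_]′)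
open import Data.Sum.Properties using (inj₁-injective; inj₂-injective)
open import Data.Vec.Functional using () renaming (_∷_ to _◃_)
open import Data.Empty using (⊥-elim)
open import Function using (_∘_)
open import Function.Definitions using (Injective)
open import Level using (0ℓ)
open import Relation.Binary using (Rel; Symmetric)
open import Relation.Binary.PropositionalEquality
  using (_≡_; _≢_; refl; sym; trans; cong; subst; subst₂; module ≡-Reasoning)
open import Relation.Nullary using (¬_; Dec; yes; no; ¬?)
open import Relation.Nullary.Decidable using (_×-dec_; decidable-stable; map′)
open import Relation.Unary using (Decidable)

m+n≤o+p⇒o≤m⇒n≤p : ∀ {m n o p} → m + n ≤ o + p → o ≤ m → n ≤ p
m+n≤o+p⇒o≤m⇒n≤p {n = n} {p = p} m+n≤o+p o≤m with n ≤? p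
... | yes n≤p = n≤p
... | no  n≰p = ⊥-elim (<⇒≱ (+-mono-≤-< o≤m (≰⇒> n≰p)) m+n≤o+p)

t+t≤2+[a+b]⇒t≤1+a⊎t≤b : ∀ {t a b} → t + t ≤ 2 + (a + b) → t ≤ suc a ⊎ t ≤ b
t+t≤2+[a+b]⇒t≤1+a⊎t≤b {t} {a} {b} t+t≤ with t ≤? b
... | yes t≤b = inj₂ t≤b
... | no  t≰b = inj₁ (m+n≤o+p⇒o≤m⇒n≤p (subst (t + t ≤_) (swap a b) t+t≤) (≰⇒> t≰b))
  where
  swap : ∀ a b → 2 + (a + b) ≡ suc b + suc a
  swap = solve-∀

t+t≤2+[2*t∸2] : ∀ {t} → 2 ≤ t → t + t ≤ 2 + (2 * t ∸ 2)
t+t≤2+[2*t∸2] {suc zero}    (s≤s ())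
t+t≤2+[2*t∸2] {suc (suc u)} _        = ≤-reflexive (expand u)
  where
  expand : ∀ u → suc (suc u) + suc (suc u) ≡ 2 + (u + suc (suc (u + 0)))
  expand = solve-∀

-- The Erdős–Szekeres recursion: an upper bound for the Ramsey number R(a, b).
ramsey : ℕ → ℕ → ℕ
ramsey zero    _       = 0
ramsey (suc a) zero    = 0
ramsey (suc a) (suc b) = suc (ramsey a (suc b) + ramsey (suc a) b)

ramsey-1 : ∀ a → ramsey a 1 ≡ a
ramsey-1 zero    = refl
ramsey-1 (suc a) = cong suc (trans (+-identityʳ _) (ramsey-1 a))

ramsey-2-≤ : ∀ a → ramsey a 2 ≤ a * suc a
ramsey-2-≤ zero    = z≤n
ramsey-2-≤ (suc a) = begin
  suc (ramsey a 2 + ramsey (suc a) 1) ≤⟨ s≤s (+-mono-≤ (ramsey-2-≤ a) (≤-reflexive (ramsey-1 (suc a)))) ⟩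
  suc (a * suc a + suc a)             ≤⟨ m≤m+n _ a ⟩
  suc (a * suc a + suc a) + a         ≡⟨ expand a ⟩
  suc a * suc (suc a)                 ∎
  where
  open ≤-Reasoning
  expand : ∀ a → suc (a * suc a + suc a) + a ≡ suc a * suc (suc a)
  expand = solve-∀

ramsey-3-≤ : ∀ a → ramsey a 3 ≤ a * (suc a * suc a)
ramsey-3-≤ zero    = z≤n
ramsey-3-≤ (suc a) = begin
  suc (ramsey a 3 + ramsey (suc a) 2)                  ≤⟨ s≤s (+-mono-≤ (ramsey-3-≤ a) (ramsey-2-≤ (suc a))) ⟩
  suc (a * (suc a * suc a) + suc a * suc (suc a))       ≤⟨ m≤m+n _ (2 * a * a + 4 * a + 1) ⟩
  suc (a * (suc a * suc a) + suc a * suc (suc a)) + (2 * a * a + 4 * a + 1) ≡⟨ expand a ⟩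
  suc a * (suc (suc a) * suc (suc a))                  ∎
  where
  open ≤-Reasoning
  expand : ∀ a → suc (a * (suc a * suc a) + suc a * suc (suc a)) + (2 * a * a + 4 * a + 1)
               ≡ suc a * (suc (suc a) * suc (suc a))
  expand = solve-∀

addConst : ℕ → Poly → Poly
addConst c []       = c ∷ []
addConst c (a ∷ as) = c + a ∷ as

eval-addConst : ∀ c f x → eval (addConst c f) x ≡ c + eval f x
eval-addConst c []       x = cong (c +_) (*-zeroʳ x)
eval-addConst c (a ∷ as) x = +-assoc c a _

scale : ℕ → Poly → Poly
scale k = map (k *_)

eval-scale : ∀ k f x → eval (scale k f) x ≡ k * eval f x
eval-scale k []       x = sym (*-zeroʳ k)
eval-scale k (a ∷ as) x = begin
  k * a + x * eval (scale k as) x ≡⟨ cong (λ e → k * a + x * e) (eval-scale k as x) ⟩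
  k * a + x * (k * eval as x)     ≡⟨ factor k a x (eval as x) ⟩
  k * (a + x * eval as x)         ∎
  where
  open ≡-Reasoning
  factor : ∀ k a x e → k * a + x * (k * e) ≡ k * (a + x * e)
  factor = solve-∀

module _ {A : Set} where

  length-filter-∁ : {P : A → Set} (P? : Decidable P) → ∀ xs →
                    length (filter P? xs) + length (filter (¬? ∘ P?) xs) ≡ length xs
  length-filter-∁ P? []       = refl
  length-filter-∁ P? (x ∷ xs) with P? x
  ... | yes _ = cong suc (length-filter-∁ P? xs)
  ... | no  _ = trans (+-suc _ _) (cong suc (length-filter-∁ P? xs))

  Pairwise : ∀ {n} → Rel A 0ℓ → (Fin n → A) → Set
  Pairwise R f = ∀ i j → i ≢ j → R (f i) (f j)

  record Family (R : Rel A 0ℓ) (n : ℕ) (xs : List A) : Set where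
    constructor mkFamily
    field
      member   : Fin n → A
      pairwise : Pairwise R member
      ∈-list   : ∀ i → member i ∈ xs

  pairwise-injective : ∀ {n} {R : Rel A 0ℓ} {f : Fin n → A} →
                       (∀ {x y} → R x y → x ≢ y) → Pairwise R f → Injective _≡_ _≡_ f
  pairwise-injective R⇒≢ Rf {i} {j} fi≡fj = decidable-stable (i ≟ j) λ i≢j → R⇒≢ (Rf i j i≢j) fi≡fj

  module _ {R : Rel A 0ℓ} where

    ∅-family : ∀ {xs} → Family R 0 xs
    ∅-family = mkFamily (λ ()) (λ ()) (λ ())

    family-⊆ : ∀ {n xs ys} → xs ⊆ ys → Family R n xs → Family R n ys
    family-⊆ xs⊆ys (mkFamily f Rf f∈) = mkFamily f Rf (xs⊆ys ∘ f∈)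

  module _ {R : Rel A 0ℓ} (R-sym : Symmetric R) where

    lookup-pairwise : ∀ {xs} → AllPairs R xs → Pairwise R (lookup xs)
    lookup-pairwise (_  ∷ _)   zero    zero    i≢j = ⊥-elim (i≢j refl)
    lookup-pairwise (Rx ∷ _)   zero    (suc j) _   = All.lookup Rx (∈-lookup j)
    lookup-pairwise (Rx ∷ _)   (suc i) zero    _   = R-sym (All.lookup Rx (∈-lookup i))
    lookup-pairwise (_  ∷ Rxs) (suc i) (suc j) i≢j = lookup-pairwise Rxs i j (i≢j ∘ cong suc)

    family-∷ : ∀ {n x xs ys} → ys ⊆ xs → (∀ {y} → y ∈ ys → R x y) → Family R n ys →
               Family R (suc n) (x ∷ xs)
    family-∷ {n} {x} {xs} ys⊆xs Rx (mkFamily f Rf f∈) = mkFamily g Rg g∈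
      where
      g : Fin (suc n) → A
      g zero    = x
      g (suc i) = f i
      Rg : Pairwise R g
      Rg zero    zero    i≢j = ⊥-elim (i≢j refl)
      Rg zero    (suc j) _   = Rx (f∈ j)
      Rg (suc i) zero    _   = R-sym (Rx (f∈ i))
      Rg (suc i) (suc j) i≢j = Rf i j (i≢j ∘ cong suc)
      g∈ : ∀ i → g i ∈ x ∷ xs
      g∈ zero    = here refl
      g∈ (suc i) = there (ys⊆xs (f∈ i))

    AllPairs⇒Family : ∀ {n xs} → AllPairs R xs → n ≤ length xs → Family R n xs
    AllPairs⇒Family {zero}  _          _        = ∅-family
    AllPairs⇒Family {suc n} (Rx ∷ Rxs) (s≤s n≤) = family-∷ ⊆-refl (All.lookup Rx) (AllPairs⇒Family Rxs n≤)

  lookup-injective : ∀ {xs} → Unique xs → Injective _≡_ _≡_ (lookup xs)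
  lookup-injective xs! = pairwise-injective (λ x≢y → x≢y) (lookup-pairwise (λ x≢y → x≢y ∘ sym) xs!)

∃-list? : ∀ {n} p {P : List (Fin n) → Set} → Decidable P → Dec (∃ λ xs → length xs ≡ p × P xs)
∃-list? zero    P? = map′ (λ P[] → [] , refl , P[]) (λ { ([] , refl , P[]) → P[] }) (P? [])
∃-list? (suc p) P? = map′ (λ { (x , xs , len , Pxs) → x ∷ xs , cong suc len , Pxs })
                          (λ { (x ∷ xs , refl , Pxs) → x , xs , refl , Pxs })
                          (any? λ x → ∃-list? p (P? ∘ (x ∷_)))

∃-∉ : ∀ {D} (cs : List (Fin (suc D))) → length cs ≤ D → ∃ λ c → c ∉ cs
∃-∉ cs len≤ = decidable-stable (any? λ c → ¬? (Any.any? (c ≟_) cs)) λ ¬∃ →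
  not-all λ c → decidable-stable (Any.any? (c ≟_) cs) λ c∉cs → ¬∃ (c , c∉cs)
  where
  not-all : ¬ (∀ c → c ∈ cs)
  not-all every with i , j , i<j , same ← pigeonhole (s≤s len≤) (index ∘ every) =
    <⇒≢ i<j (trans (lookup-index (every i)) (trans (cong (lookup cs) same) (sym (lookup-index (every j)))))

module _ {A T : Set} (test : T → A → Bool) where

  Homogeneous : List T → List A → Set
  Homogeneous Q X = ∀ {q} → q ∈ Q → ∀ {x y} → x ∈ X → y ∈ X → test q x ≡ test q y

  length-≤-homogeneous-parts : ∀ B Q X → Unique X →
    (∀ Y → Unique Y → Y ⊆ X → Homogeneous Q Y → length Y ≤ B) → length X ≤ 2 ^ length Q * B
  length-≤-homogeneous-parts B []      X X! small =
    subst (length X ≤_) (sym (+-identityʳ B)) (small X X! ⊆-refl λ ())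
  length-≤-homogeneous-parts B (q ∷ Q) X X! small = begin
    length X                                            ≡⟨ sym (length-filter-∁ passes? X) ⟩
    length (filter passes? X) + length (filter (¬? ∘ passes?) X)
                                                        ≤⟨ +-mono-≤ (part passes? (λ pass → pass))
                                                                    (part (¬? ∘ passes?) ¬-not) ⟩
    M + M                                               ≡⟨ cong (M +_) (sym (+-identityʳ M)) ⟩
    2 * M                                               ≡⟨ sym (*-assoc 2 (2 ^ length Q) B) ⟩
    2 ^ length (q ∷ Q) * B                              ∎
    where
    open ≤-Reasoning
    M : ℕ
    M = 2 ^ length Q * B
    passes? : Decidable (λ x → test q x ≡ true)
    passes? x = test q x ≟ᵇ true
    part : {P : A → Set} (P? : Decidable P) {b : Bool} → (∀ {x} → P x → test q x ≡ b) →
           length (filter P? X) ≤ M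
    part P? {b} P⇒b = length-≤-homogeneous-parts B Q (filter P? X) (Unique.filter⁺ P? X!) λ Y Y! Y⊆ Y-hom →
      small Y Y! (filter-⊆ P? X ∘ Y⊆) λ
        { (here refl) x∈Y y∈Y → trans (is-b (Y⊆ x∈Y)) (sym (is-b (Y⊆ y∈Y)))
        ; (there q∈Q)         → Y-hom q∈Q
        }
      where
      is-b : ∀ {x} → x ∈ filter P? X → test q x ≡ b
      is-b = P⇒b ∘ proj₂ ∘ ∈-filter⁻ P? {xs = X}

module _ {A B C : Set} {f : A → C} {g : B → C} where

  [,]-injective : Injective _≡_ _≡_ f → Injective _≡_ _≡_ g → (∀ a b → f a ≢ g b) →
                  Injective _≡_ _≡_ [ f , g ]′
  [,]-injective f-inj g-inj f≢g {inj₁ a} {inj₁ a′} eq = cong inj₁ (f-inj eq)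
  [,]-injective f-inj g-inj f≢g {inj₁ a} {inj₂ b}  eq = ⊥-elim (f≢g a b eq)
  [,]-injective f-inj g-inj f≢g {inj₂ b} {inj₁ a}  eq = ⊥-elim (f≢g a b (sym eq))
  [,]-injective f-inj g-inj f≢g {inj₂ b} {inj₂ b′} eq = cong inj₂ (g-inj eq)

◃-injective : ∀ {A : Set} {n} {x : A} {f : Fin n → A} →
              Injective _≡_ _≡_ f → (∀ i → x ≢ f i) → Injective _≡_ _≡_ (x ◃ f)
◃-injective f-inj x≢f {zero}  {zero}  eq = refl
◃-injective f-inj x≢f {zero}  {suc j} eq = ⊥-elim (x≢f j eq)
◃-injective f-inj x≢f {suc i} {zero}  eq = ⊥-elim (x≢f i (sym eq))
◃-injective f-inj x≢f {suc i} {suc j} eq = cong suc (f-inj eq)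

splitAt-injective : ∀ m {n} → Injective _≡_ _≡_ (splitAt m {n})
splitAt-injective m {n} {u} {v} eq =
  trans (sym (join-splitAt m n u)) (trans (cong (join m n) eq) (join-splitAt m n v))

join-injective : ∀ m n → Injective _≡_ _≡_ (join m n)
join-injective m n {u} {v} eq =
  trans (sym (splitAt-join m n u)) (trans (cong (splitAt m) eq) (splitAt-join m n v))

Colorable-mono : ∀ {G c c′} → c ≤ c′ → Colorable G c → Colorable G c′
Colorable-mono c≤c′ (col , proper) =
  (λ u → inject≤ (col u) c≤c′) , λ u v u~v → proper u v u~v ∘ inject≤-injective c≤c′ c≤c′ _ _

module GraphProperties (G : Graph) where

  V : Set
  V = Fin (size G)

  infix 4 _~_ _≁_ _~?_

  _~_ : V → V → Set
  _~_ = Adj G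

  _≁_ : V → V → Set
  x ≁ y = x ≢ y × edge G x y ≡ false

  _~?_ : ∀ x y → Dec (x ~ y)
  x ~? y = edge G x y ≟ᵇ true

  ~-sym : Symmetric _~_
  ~-sym {x} {y} x~y = trans (esym G y x) x~y

  ≁-sym : Symmetric _≁_
  ≁-sym {x} {y} (x≢y , x≁y) = x≢y ∘ sym , trans (esym G y x) x≁y

  ~⇒≢ : ∀ {x y} → x ~ y → x ≢ y
  ~⇒≢ {x} x~x refl = not-¬ (irref G x) x~x

  ramsey-theorem : ∀ a b X → Unique X → ramsey a b ≤ length X → Family _~_ a X ⊎ Family _≁_ b X
  ramsey-theorem zero    b       X       _          _        = inj₁ ∅-family
  ramsey-theorem (suc a) zero    X       _          _        = inj₂ ∅-family
  ramsey-theorem (suc a) (suc b) (x ∷ X) (x∉X ∷ X!) (s≤s R≤) with ramsey a (suc b) ≤? length N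
    where
    N : List V
    N = filter (x ~?_) X
  ... | yes R≤N = [ inj₁ ∘ family-∷ ~-sym (filter-⊆ _ X) (proj₂ ∘ ∈-filter⁻ (x ~?_) {xs = X})
                  , inj₂ ∘ family-⊆ (there ∘ filter-⊆ _ X) ]′
                  (ramsey-theorem a (suc b) _ (Unique.filter⁺ _ X!) R≤N)
  ... | no  R≰N = [ inj₁ ∘ family-⊆ (there ∘ filter-⊆ _ X)
                  , inj₂ ∘ family-∷ ≁-sym (filter-⊆ _ X) x≁ ]′
                  (ramsey-theorem (suc a) b _ (Unique.filter⁺ _ X!)
                    (m+n≤o+p⇒o≤m⇒n≤p (subst (_ ≤_) (sym (length-filter-∁ (x ~?_) X)) R≤) (<⇒≤ (≰⇒> R≰N))))
    where
    x≁ : ∀ {y} → y ∈ filter (¬? ∘ (x ~?_)) X → x ≁ y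
    x≁ y∈ with y∈X , x≁y ← ∈-filter⁻ (¬? ∘ (x ~?_)) y∈ = All.lookup x∉X y∈X , ¬-not x≁y

  clique-edge : ∀ {n} {c : Fin n → V} → Pairwise _~_ c → ∀ a b → edge G (c a) (c b) ≡ neq a b
  clique-edge {c = c} c~ a b with a ≟ b
  ... | yes refl = irref G (c a)
  ... | no  a≢b  = c~ a b a≢b

  independent-edge : ∀ {n} {d : Fin n → V} → Pairwise _≁_ d → ∀ a b → edge G (d a) (d b) ≡ false
  independent-edge {d = d} d≁ a b with a ≟ b
  ... | yes refl = irref G (d a)
  ... | no  a≢b  = proj₂ (d≁ a b a≢b)

  clique-injective : ∀ {n} {c : Fin n → V} → Pairwise _~_ c → Injective _≡_ _≡_ c
  clique-injective = pairwise-injective ~⇒≢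

  independent-injective : ∀ {n} {d : Fin n → V} → Pairwise _≁_ d → Injective _≡_ _≡_ d
  independent-injective = pairwise-injective {R = _≁_} proj₁

  join-embedding : ∀ {t r} (c : Fin t → V) (d : Fin r → V) →
                   Pairwise _~_ c → Pairwise _≁_ d → (∀ i j → c i ~ d j) → InducedSub (KJoinIndep t r) G
  join-embedding {t} {r} c d c~ d≁ c~d =
    [ c , d ]′ ∘ splitAt t ,
    splitAt-injective t ∘ [,]-injective (clique-injective c~) (independent-injective d≁) (λ i j → ~⇒≢ (c~d i j)) ,
    edges
    where
    edges : ∀ u v → edge G ([ c , d ]′ (splitAt t u)) ([ c , d ]′ (splitAt t v)) ≡ joinE t r u v
    edges u v with splitAt t u | splitAt t v
    ... | inj₁ a | inj₁ b = clique-edge c~ a b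
    ... | inj₁ a | inj₂ b = c~d a b
    ... | inj₂ a | inj₁ b = ~-sym (c~d b a)
    ... | inj₂ a | inj₂ b = independent-edge d≁ a b

  bowtie-embedding : ∀ {s t} x (c₁ : Fin s → V) (c₂ : Fin t → V) → Pairwise _~_ c₁ → Pairwise _~_ c₂ →
                     (∀ i → x ~ c₁ i) → (∀ j → x ~ c₂ j) → (∀ i j → c₁ i ≁ c₂ j) → InducedSub (Bowtie s t) G
  bowtie-embedding {s} {t} x c₁ c₂ c₁~ c₂~ x~c₁ x~c₂ c₁≁c₂ =
    x ◃ (ψ ∘ splitAt s) ,
    ◃-injective (splitAt-injective s ∘
                 [,]-injective (clique-injective c₁~) (clique-injective c₂~) (λ i j → proj₁ (c₁≁c₂ i j)))
                (λ u → ~⇒≢ (x~ψ (splitAt s u))) ,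
    edges
    where
    ψ : Fin s ⊎ Fin t → V
    ψ = [ c₁ , c₂ ]′
    x~ψ : ∀ y → x ~ ψ y
    x~ψ (inj₁ i) = x~c₁ i
    x~ψ (inj₂ j) = x~c₂ j
    edges : ∀ u v → edge G ((x ◃ (ψ ∘ splitAt s)) u) ((x ◃ (ψ ∘ splitAt s)) v) ≡ bowE s t u v
    edges zero    zero    = irref G x
    edges zero    (suc v) = x~ψ (splitAt s v)
    edges (suc u) zero    = ~-sym (x~ψ (splitAt s u))
    edges (suc u) (suc v) with splitAt s u | splitAt s v
    ... | inj₁ a | inj₁ b = clique-edge c₁~ a b
    ... | inj₁ a | inj₂ b = proj₂ (c₁≁c₂ a b)
    ... | inj₂ a | inj₁ b = proj₂ (≁-sym (c₁≁c₂ b a))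
    ... | inj₂ a | inj₂ b = clique-edge c₂~ a b

  lollipop-embedding : ∀ {k t} x (d : Fin (k ∸ 1) → V) (c : Fin t → V) → Pairwise _≁_ d → Pairwise _~_ c →
                       (∀ i → x ~ d i) → (∀ j → x ~ c j) → (∀ i j → d i ≁ c j) → InducedSub (Lollipop k t) G
  lollipop-embedding {k} {t} x d c d≁ c~ x~d x~c d≁c =
    x ◃ (ψ ∘ splitAt (k ∸ 1)) ,
    ◃-injective (splitAt-injective (k ∸ 1) ∘
                 [,]-injective (independent-injective d≁) (clique-injective c~) (λ i j → proj₁ (d≁c i j)))
                (λ u → ~⇒≢ (x~ψ (splitAt (k ∸ 1) u))) ,
    edges
    where
    ψ : Fin (k ∸ 1) ⊎ Fin t → V
    ψ = [ d , c ]′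
    x~ψ : ∀ y → x ~ ψ y
    x~ψ (inj₁ i) = x~d i
    x~ψ (inj₂ j) = x~c j
    edges : ∀ u v → edge G ((x ◃ (ψ ∘ splitAt (k ∸ 1))) u) ((x ◃ (ψ ∘ splitAt (k ∸ 1))) v) ≡ lolE (k ∸ 1) t u v
    edges zero    zero    = irref G x
    edges zero    (suc v) = x~ψ (splitAt (k ∸ 1) v)
    edges (suc u) zero    = ~-sym (x~ψ (splitAt (k ∸ 1) u))
    edges (suc u) (suc v) with splitAt (k ∸ 1) u | splitAt (k ∸ 1) v
    ... | inj₁ a | inj₁ b = independent-edge d≁ a b
    ... | inj₁ a | inj₂ b = proj₂ (d≁c a b)
    ... | inj₂ a | inj₁ b = proj₂ (≁-sym (d≁c b a))
    ... | inj₂ a | inj₂ b = clique-edge c~ a b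

  Anticomplete : List V → List V → Set
  Anticomplete X Z = All (λ y → All (λ z → edge G y z ≡ false) Z) X

  Complete : List V → List V → Set
  Complete X Z = All (λ y → All (y ~_) Z) X

  anticomplete-∉ : ∀ {y Z} → AllPairs _~_ Z → 2 ≤ length Z → All (λ z → edge G y z ≡ false) Z → y ∉ Z
  anticomplete-∉ {Z = _ ∷ []}    _         (s≤s ())       _              _
  anticomplete-∉ {Z = _ ∷ _ ∷ _} (z~Z ∷ _) _              (_ ∷ y≁z′ ∷ _) (here refl)  =
    not-¬ y≁z′ (All.lookup z~Z (here refl))
  anticomplete-∉                 (z~Z ∷ _) _              (y≁z ∷ _)      (there y∈Z) =
    not-¬ y≁z (~-sym (All.lookup z~Z y∈Z))

  anticomplete-≁ : ∀ {X Z y z} → AllPairs _~_ Z → 2 ≤ length Z → Anticomplete X Z → y ∈ X → z ∈ Z → y ≁ z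
  anticomplete-≁ Z~ 2≤Z X≁Z y∈X z∈Z =
    (λ { refl → anticomplete-∉ Z~ 2≤Z (All.lookup X≁Z y∈X) z∈Z }) , All.lookup (All.lookup X≁Z y∈X) z∈Z

  complete-∷ : ∀ {x X Z y u} → All (x ~_) X → Complete X Z → y ∈ x ∷ Z → u ∈ X → y ~ u
  complete-∷ x~X X~Z (here refl) u∈X = All.lookup x~X u∈X
  complete-∷ x~X X~Z (there y∈Z) u∈X = ~-sym (All.lookup (All.lookup X~Z u∈X) y∈Z)

  bowtie-or-lollipop : ∀ {s t k x Z X} → 2 ≤ t → AllPairs _~_ Z → t ≤ length Z → All (x ~_) Z →
                       Unique X → All (x ~_) X → Anticomplete X Z → ramsey s (k ∸ 1) ≤ length X →
                       InducedSub (Bowtie s t) G ⊎ InducedSub (Lollipop k t) G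
  bowtie-or-lollipop {s} {t} {k} {x} {Z} {X} 2≤t Z~ t≤Z x~Z X! x~X X≁Z R≤X
    with mkFamily c c~ c∈Z ← AllPairs⇒Family ~-sym Z~ t≤Z
    with ramsey-theorem s (k ∸ 1) X X! R≤X
  ... | inj₁ (mkFamily c₁ c₁~ c₁∈X) =
    inj₁ (bowtie-embedding x c₁ c c₁~ c~ (All.lookup x~X ∘ c₁∈X) (All.lookup x~Z ∘ c∈Z)
            λ i j → anticomplete-≁ Z~ (≤-trans 2≤t t≤Z) X≁Z (c₁∈X i) (c∈Z j))
  ... | inj₂ (mkFamily d d≁ d∈X) =
    inj₂ (lollipop-embedding {k} x d c d≁ c~ (All.lookup x~X ∘ d∈X) (All.lookup x~Z ∘ c∈Z)
            λ i j → anticomplete-≁ Z~ (≤-trans 2≤t t≤Z) X≁Z (d∈X i) (c∈Z j))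

  clique-or-join : ∀ {t r w x Z X} → AllPairs _~_ Z → t ≤ suc (length Z) → All (x ~_) Z →
                   Unique X → All (x ~_) X → Complete X Z → ramsey (suc w) r ≤ length X →
                   HasClique G (suc w) ⊎ InducedSub (KJoinIndep t r) G
  clique-or-join {t} {r} {w} Z~ t≤1+Z x~Z X! x~X X~Z R≤X
    with mkFamily c c~ c∈xZ ← AllPairs⇒Family ~-sym (x~Z ∷ Z~) t≤1+Z
    with ramsey-theorem (suc w) r _ X! R≤X
  ... | inj₁ (mkFamily k k~ _)   = inj₁ (k , clique-injective k~ , k~)
  ... | inj₂ (mkFamily d d≁ d∈X) = inj₂ (join-embedding c d c~ d≁ λ i j → complete-∷ x~X X~Z (c∈xZ i) (d∈X j))

  homogeneous-split : ∀ {Q y₀ Y} → Homogeneous (edge G) Q (y₀ ∷ Y) →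
                      Anticomplete (y₀ ∷ Y) (filter (¬? ∘ (_~? y₀)) Q) × Complete (y₀ ∷ Y) (filter (_~? y₀) Q)
  homogeneous-split {Q} {y₀} {Y} hom =
    All.tabulate (λ y∈ → All.tabulate λ z∈Z₀ → let z∈Q , z≁y₀ = ∈-filter⁻ (¬? ∘ (_~? y₀)) {xs = Q} z∈Z₀ in
                                                  trans (as-y₀ z∈Q y∈) (¬-not z≁y₀)) ,
    All.tabulate (λ y∈ → All.tabulate λ z∈Z₁ → let z∈Q , z~y₀ = ∈-filter⁻ (_~? y₀) {xs = Q} z∈Z₁ in
                                                  trans (as-y₀ z∈Q y∈) z~y₀)
    where
    as-y₀ : ∀ {y z} → z ∈ Q → y ∈ y₀ ∷ Y → edge G y z ≡ edge G z y₀
    as-y₀ {y} {z} z∈Q y∈ = trans (esym G y z) (hom z∈Q y∈ (here refl))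

  induced : List V → Graph
  induced L = record
    { size  = length L
    ; edge  = λ i j → edge G (lookup L i) (lookup L j)
    ; esym  = λ i j → esym G (lookup L i) (lookup L j)
    ; irref = λ i → irref G (lookup L i)
    }

  induced-sub : ∀ {L} → Unique L → InducedSub (induced L) G
  induced-sub {L} L! = lookup L , lookup-injective L! , λ _ _ → refl

  Heavy : ℕ → V → Set
  Heavy p x = ∃ λ Q → length Q ≡ p × AllPairs _~_ Q × All (x ~_) Q

  heavy? : ∀ p x → Dec (Heavy p x)
  heavy? p x = ∃-list? p λ Q → allPairs? _~?_ Q ×-dec All.all? (x ~?_) Q

  light-clique-≤ : ∀ {p L} → All (¬_ ∘ Heavy p) L → CliqueAtMost (induced L) p
  light-clique-≤ {L = L} L-light (ψ , _ , ψ~) =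
    All.lookup L-light (∈-lookup (ψ zero))
      ( tabulate (lookup L ∘ ψ ∘ suc) , length-tabulate _
      , AllPairs-tabulate⁺ (λ i≢j → ψ~ _ _ (i≢j ∘ suc-injective))
      , All-tabulate⁺ (λ i → ψ~ zero (suc i) λ ()))

  ColoringOn : (V → Set) → ℕ → Set
  ColoringOn P c = Σ (∀ {u} → P u → Fin c) λ col → ∀ {u v} (pu : P u) (pv : P v) → u ~ v → col pu ≢ col pv

  ColoringOn-restrict : ∀ {P Q : V → Set} {c} → (∀ {u} → P u → Q u) → ColoringOn Q c → ColoringOn P c
  ColoringOn-restrict P⇒Q (col , proper) = col ∘ P⇒Q , λ pu pv → proper (P⇒Q pu) (P⇒Q pv)

  colorable-+ : ∀ {P : V → Set} {a b} → Decidable P → ColoringOn P a → ColoringOn (¬_ ∘ P) b → Colorable G (a + b)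
  colorable-+ {P} {a} {b} P? (col₁ , proper₁) (col₂ , proper₂) =
    join a b ∘ side , λ u v u~v → side-proper u v u~v ∘ join-injective a b
    where
    side : V → Fin a ⊎ Fin b
    side u with P? u
    ... | yes pu = inj₁ (col₁ pu)
    ... | no ¬pu = inj₂ (col₂ ¬pu)
    side-proper : ∀ u v → u ~ v → side u ≢ side v
    side-proper u v u~v with P? u | P? v
    ... | yes pu  | yes pv  = proper₁ pu pv u~v ∘ inj₁-injective
    ... | yes _   | no  _   = λ ()
    ... | no  _   | yes _   = λ ()
    ... | no  ¬pu | no  ¬pv = proper₂ ¬pu ¬pv u~v ∘ inj₂-injective

  induced-coloring : ∀ {L c} → Colorable (induced L) c → ColoringOn (_∈ L) c
  induced-coloring (col , proper) =
    (λ u∈L → col (index u∈L)) ,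
    λ u∈L v∈L u~v → proper _ _ (subst₂ _~_ (lookup-index u∈L) (lookup-index v∈L) u~v)

  DegreeAtMost : ℕ → V → Set
  DegreeAtMost D x = ∀ X → Unique X → All (x ~_) X → length X ≤ D

  ProperOn : ∀ {c} → List V → (V → Fin c) → Set
  ProperOn L col = ∀ {u v} → u ∈ L → v ∈ L → u ~ v → col u ≢ col v

  _[_≔_] : ∀ {B : Set} → (V → B) → V → B → V → B
  (f [ x ≔ b ]) u with u ≟ x
  ... | yes _ = b
  ... | no  _ = f u

  ≔-same : ∀ {B : Set} (f : V → B) x b → (f [ x ≔ b ]) x ≡ b
  ≔-same f x b with x ≟ x
  ... | yes _   = refl
  ... | no  x≢x = ⊥-elim (x≢x refl)

  ≔-other : ∀ {B : Set} (f : V → B) {x u} b → u ≢ x → (f [ x ≔ b ]) u ≡ f u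
  ≔-other f {x} {u} b u≢x with u ≟ x
  ... | yes u≡x = ⊥-elim (u≢x u≡x)
  ... | no  _   = refl

  proper-∷ : ∀ {c x L} {col : V → Fin c} {a} → All (x ≢_) L → ProperOn L col →
             (∀ {v} → v ∈ L → x ~ v → a ≢ col v) → ProperOn (x ∷ L) (col [ x ≔ a ])
  proper-∷ {x = x} {L} {col} {a} x∉L proper a-free = λ
    { (here refl) (here refl)   x~x → ⊥-elim (~⇒≢ x~x refl)
    ; (here refl) (there v∈L)   x~v eq → a-free v∈L x~v (trans (sym (≔-same col x a)) (trans eq (other v∈L)))
    ; (there u∈L) (here refl)   u~x eq → a-free u∈L (~-sym u~x) (trans (sym (≔-same col x a)) (trans (sym eq) (other u∈L)))
    ; (there u∈L) (there v∈L)   u~v eq → proper u∈L v∈L u~v (trans (sym (other u∈L)) (trans eq (other v∈L)))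
    }
    where
    other : ∀ {v} → v ∈ L → (col [ x ≔ a ]) v ≡ col v
    other v∈L = ≔-other col a (All.lookup x∉L v∈L ∘ sym)

  greedy-coloring : ∀ D L → Unique L → All (DegreeAtMost D) L → Σ (V → Fin (suc D)) (ProperOn L)
  greedy-coloring D []      _          _                = (λ _ → zero) , λ ()
  greedy-coloring D (x ∷ L) (x∉L ∷ L!) (x-deg ∷ L-deg)
    with col , proper ← greedy-coloring D L L! L-deg
    with a , a∉ ← ∃-∉ (map col (filter (x ~?_) L))
                      (subst (_≤ D) (sym (length-map col (filter (x ~?_) L)))
                        (x-deg _ (Unique.filter⁺ (x ~?_) L!) (all-filter (x ~?_) L)))
    = col [ x ≔ a ] , proper-∷ x∉L proper λ v∈L x~v a≡cv →
        a∉ (subst (_∈ map col (filter (x ~?_) L)) (sym a≡cv) (∈-map⁺ col (∈-filter⁺ (x ~?_) v∈L x~v)))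

module _ (G : Graph) {s t k r w : ℕ} (2≤t : 2 ≤ t)
         (bowtie-free : Free (Bowtie s t) G) (lollipop-free : Free (Lollipop k t) G)
         (join-free : Free (KJoinIndep t r) G) (ω≤w : CliqueAtMost G w) where
  open GraphProperties G

  part-bound : ℕ
  part-bound = ramsey s (k ∸ 1) + ramsey (suc w) r

  homogeneous-part-≤ : ∀ {x Q} → AllPairs _~_ Q → All (x ~_) Q → t + t ≤ 2 + length Q →
                       ∀ Y → Unique Y → All (x ~_) Y → Homogeneous (edge G) Q Y → length Y ≤ part-bound
  homogeneous-part-≤ _ _ _ [] _ _ _ = z≤n
  homogeneous-part-≤ {x} {Q} Q~ x~Q t+t≤ (y₀ ∷ Y) Y! x~Y hom
    with Y≁Z₀ , Y~Z₁ ← homogeneous-split hom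
    with t+t≤2+[a+b]⇒t≤1+a⊎t≤b (subst (λ n → t + t ≤ 2 + n) (sym (length-filter-∁ (_~? y₀) Q)) t+t≤)
  ... | inj₁ t≤1+Z₁ = ≤-trans (≰⇒≥ λ R≤Y → [ ω≤w , join-free ]′
                        (clique-or-join (AllPairs-filter⁺ _ Q~) t≤1+Z₁ (filter⁺ _ x~Q) Y! x~Y Y~Z₁ R≤Y))
                      (m≤n+m _ _)
  ... | inj₂ t≤Z₀   = ≤-trans (≰⇒≥ λ R≤Y → [ bowtie-free , lollipop-free ]′
                        (bowtie-or-lollipop {k = k} 2≤t (AllPairs-filter⁺ _ Q~) t≤Z₀ (filter⁺ _ x~Q) Y! x~Y Y≁Z₀ R≤Y))
                      (m≤m+n _ _)

  heavy-degree : ∀ {p x} → t + t ≤ 2 + p → Heavy p x → DegreeAtMost (2 ^ p * part-bound) x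
  heavy-degree t+t≤ (Q , refl , Q~ , x~Q) X X! x~X =
    length-≤-homogeneous-parts (edge G) part-bound Q X X! λ Y Y! Y⊆X →
      homogeneous-part-≤ Q~ x~Q t+t≤ Y Y! (anti-mono Y⊆X x~X)

  colorable : ∀ {p m} → t + t ≤ 2 + p → ChiNBounded p G m → Colorable G (m + suc (2 ^ p * part-bound))
  colorable {p} {m} t+t≤ χ-bound = colorable-+ (¬? ∘ heavy? p) light-coloring heavy-coloring
    where
    Lights Heavies : List V
    Lights = filter (¬? ∘ heavy? p) (allFin (size G))
    Heavies = filter (heavy? p) (allFin (size G))

    Lights! : Unique Lights
    Lights! = Unique.filter⁺ (¬? ∘ heavy? p) (allFin⁺ (size G))

    Heavies! : Unique Heavies
    Heavies! = Unique.filter⁺ (heavy? p) (allFin⁺ (size G))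

    light-coloring : ColoringOn (¬_ ∘ Heavy p) m
    light-coloring =
      ColoringOn-restrict (∈-filter⁺ (¬? ∘ heavy? p) (∈-allFin _))
        (induced-coloring (χ-bound (induced Lights) (induced-sub Lights!)
          (light-clique-≤ (all-filter (¬? ∘ heavy? p) (allFin (size G))))))

    greedy : Σ (V → Fin (suc (2 ^ p * part-bound))) (ProperOn Heavies)
    greedy = greedy-coloring _ Heavies Heavies! (All.map (heavy-degree t+t≤) (all-filter (heavy? p) (allFin (size G))))

    heavy-∈ : ∀ {u} → ¬ ¬ Heavy p u → u ∈ Heavies
    heavy-∈ {u} ¬¬hu = ∈-filter⁺ (heavy? p) (∈-allFin u) (decidable-stable (heavy? p u) ¬¬hu)

    heavy-coloring : ColoringOn (¬_ ∘ ¬_ ∘ Heavy p) (suc (2 ^ p * part-bound))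
    heavy-coloring = (λ {u} _ → proj₁ greedy u) , λ ¬¬hu ¬¬hv → proj₂ greedy (heavy-∈ ¬¬hu) (heavy-∈ ¬¬hv)

ramsey-2-poly : ∀ w → ramsey (suc w) 2 ≤ eval (2 ∷ 3 ∷ 1 ∷ []) w
ramsey-2-poly w = ≤-trans (ramsey-2-≤ (suc w)) (≤-reflexive (expand w))
  where
  expand : ∀ w → suc w * suc (suc w) ≡ 2 + w * (3 + w * (1 + w * 0))
  expand = solve-∀

ramsey-3-poly : ∀ w → ramsey (suc w) 3 ≤ eval (4 ∷ 8 ∷ 5 ∷ 1 ∷ []) w
ramsey-3-poly w = ≤-trans (ramsey-3-≤ (suc w)) (≤-reflexive (expand w))
  where
  expand : ∀ w → suc w * (suc (suc w) * suc (suc w)) ≡ 4 + w * (8 + w * (5 + w * (1 + w * 0)))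
  expand = solve-∀

strongly-pollyanna : ∀ s t k r {p} → 2 ≤ t → t + t ≤ 2 + p →
  (f : Poly) → (∀ w → ramsey (suc w) r ≤ eval f w) →
  StronglyPollyanna p (λ G → Free (KJoinIndep t r) G × Free (Bowtie s t) G × Free (Lollipop k t) G)
strongly-pollyanna s t k r {p} 2≤t t+t≤ f R≤f F (_ , m , χ-bounded) =
  addConst c (scale K f) ,
  λ { G ((join-free , bowtie-free , lollipop-free) , in-F) w (_ , ω≤w) →
      Colorable-mono {G} (colors-≤ w)
        (colorable G {k = k} 2≤t bowtie-free lollipop-free join-free ω≤w t+t≤ (χ-bounded G in-F)) }
  where
  K c : ℕ
  K = 2 ^ p
  c = m + suc (K * ramsey s (k ∸ 1))
  colors-≤ : ∀ w → m + suc (K * (ramsey s (k ∸ 1) + ramsey (suc w) r)) ≤ eval (addConst c (scale K f)) w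
  colors-≤ w = begin
    m + suc (K * (R₀ + ramsey (suc w) r))   ≡⟨ cong (λ n → m + suc n) (*-distribˡ-+ K R₀ _) ⟩
    m + suc (K * R₀ + K * ramsey (suc w) r) ≡⟨ regroup m (K * R₀) _ ⟩
    c + K * ramsey (suc w) r               ≤⟨ +-monoʳ-≤ c (*-monoʳ-≤ K (R≤f w)) ⟩
    c + K * eval f w                       ≡⟨ cong (c +_) (sym (eval-scale K f w)) ⟩
    c + eval (scale K f) w                 ≡⟨ sym (eval-addConst c (scale K f) w) ⟩
    eval (addConst c (scale K f)) w        ∎
    where
    open ≤-Reasoning
    R₀ : ℕ
    R₀ = ramsey s (k ∸ 1)
    regroup : ∀ a b d → a + suc (b + d) ≡ a + suc b + d
    regroup = solve-∀

theorem2p7 : (s t k : ℕ) → 2 ≤ s → 2 ≤ t → 2 ≤ k →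
    (Y : Graph) → (Y ≡ F1 t ⊎ Y ≡ F2 t) →
    StronglyPollyanna (2 * t ∸ 2)
      (λ G → Free Y G × Free (Bowtie s t) G × Free (Lollipop k t) G)
theorem2p7 s t k _ 2≤t _ _ (inj₁ refl) =
  strongly-pollyanna s t k 2 2≤t (t+t≤2+[2*t∸2] 2≤t) (2 ∷ 3 ∷ 1 ∷ []) ramsey-2-poly
theorem2p7 s t k _ 2≤t _ _ (inj₂ refl) =
  strongly-pollyanna s t k 3 2≤t (t+t≤2+[2*t∸2] 2≤t) (4 ∷ 8 ∷ 5 ∷ 1 ∷ []) ramsey-3-poly
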